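{- Let $\Sigma=\mathrm{Sym}((123,132))$ and $\Delta_n=\mathrm{Sym}((\mathrm{Id}_n,\mathrm{Id}_n))$. Then $$S^2_n(\Sigma)=\begin{cases} S_n^2 & \text{if } n\le 2,\\ S_3^2\setminus \Sigma & \text{if } n=3,\\ \Delta_n & \text{if } n\ge 4.\end{cases}$$ (For $n\ge4$, $\Delta_n=\{(\mathrm{Id}_n,\mathrm{Id}_n),(\mathrm{Id}_n,\mathrm{rev}(\mathrm{Id}_n)),(\mathrm{rev}(\mathrm{Id}_n),\mathrm{Id}_n),(\mathrm{rev}(\mathrm{Id}_n),\mathrm{rev}(\mathrm{Id}_n))\}$.)
   Context: A $3$-permutation of size $n$ is a pair $(\sigma_1,\sigma_2)$ of permutations of $[n]$, with diagram $\{(i,\sigma_1(i),\sigma_2(i)) : i\in[n]\}$; $S_n^2$ is the set of all of them. A $3$-permutation $\boldsymbol\sigma$ contains a $3$-permutation pattern $\boldsymbol\pi$ if some subset of its diagram has standardization (the point set with the same relative order in each coordinate, on the grid $[k]^3$) equal to the diagram of $\boldsymbol\pi$; $S_n^2(\Sigma)$ is the set of $3$-permutations of size $n$ avoiding every pattern in $\Sigma$. For a $3\times 3$ signed permutation matrix $s$ (entries in $\{ -1,0,1\}$, one nonzero entry per row and column), $s(\boldsymbol\sigma)$ is the $3$-permutation whose diagram is the standardization of $\{sp : p\in P_{\boldsymbol\sigma}\}$, and $\mathrm{Sym}(\boldsymbol\sigma)=\{s(\boldsymbol\sigma): s \text{ a } 3\times3 \text{ signed permutation matrix}\}$. $\mathrm{Id}_n$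 is the identity permutation and $\mathrm{rev}(\sigma)(i)=\sigma(n+1-i)$. -}

module Defs where

open import Data.Nat using (ℕ)
open import Data.Fin using (Fin; _<_; opposite; zero; suc)
open import Data.Fin.Permutation using (Permutation′; _⟨$⟩ʳ_; id; transpose)
open import Data.Bool using (Bool; true; false)
open import Data.Product using (Σ; _×_; _,_; ∃; ∃-syntax)
open import Function.Bundles using (_⇔_)
open import Relation.Binary.PropositionalEquality using (_≡_)
open import Relation.Nullary using (¬_)

ThreePerm : ℕ → Set
ThreePerm n = Permutation′ n × Permutation′ n

point : ∀ {n} → ThreePerm n → Fin n → Fin 3 → Fin n
point (σ₁ , σ₂) i zero = i
point (σ₁ , σ₂) i (suc zero) = σ₁ ⟨$⟩ʳ i
point (σ₁ , σ₂) i (suc (suc zero)) = σ₂ ⟨$⟩ʳ i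

Contains : ∀ {n k} → ThreePerm n → ThreePerm k → Set
Contains {n} {k} σ π =
  Σ (Fin k → Fin n) λ f →
    ∀ (i j : Fin k) (r : Fin 3) →
      (point σ (f i) r < point σ (f j) r) ⇔ (point π i r < point π j r)

-- A 3×3 signed permutation matrix s: the nonzero entry of row r is in column
-- τ r, with sign + if ε r = true and − if ε r = false.
record SignedPermMatrix : Set where
  constructor spm
  field
    τ : Permutation′ 3
    ε : Fin 3 → Bool

-- Standardized sign: on [n], standardizing {−x} is the same as x ↦ n+1−x.
signAdj : ∀ {n} → Bool → Fin n → Fin n
signAdj true x = x
signAdj false x = opposite x

-- r-th coordinate of the standardization of s·p for the diagram point p = point π i.
actPoint : ∀ {n} → SignedPermMatrix → ThreePerm n → Fin n → Fin 3 → Fin n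
actPoint (spm τ ε) π i r = signAdj (ε r) (point π i (τ ⟨$⟩ʳ r))

-- ρ = s(π): the diagram of ρ equals the standardization of {s p : p ∈ P_π}.
-- (Both are n-point sets with distinct first coordinates, so it suffices that
-- every transformed point lies on the diagram of ρ.)
IsImage : ∀ {n} → SignedPermMatrix → ThreePerm n → ThreePerm n → Set
IsImage s π ρ = ∀ i → ∀ r → point ρ (actPoint s π i zero) r ≡ actPoint s π i r

InSym : ∀ {n} → ThreePerm n → ThreePerm n → Set
InSym ρ π = ∃[ s ] IsImage s π ρ

AvoidsSym : ∀ {n k} → ThreePerm n → ThreePerm k → Set
AvoidsSym {n} {k} σ π = ∀ (τ : ThreePerm k) → InSym τ π → ¬ Contains σ τ

IdId : ∀ n → ThreePerm n
IdId n = id , id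

-- (123, 132): 132 swaps the values at positions 2 and 3 (0-indexed 1 and 2).
p123-132 : ThreePerm 3
p123-132 = id , transpose (suc zero) (suc (suc zero))

-- On three points each of the three planar projections of a 3-permutation is
-- monotone or not, and every pattern with exactly one monotone projection is a
-- symmetric image s(123,132) (found by searching the 48 signed permutation
-- matrices). Hence for n ≥ 4 an avoider has no such triple; an exhaustive check
-- on four points then shows that both coordinates are monotone on every
-- quadruple, so σ₁ and σ₂ are each the identity or the reversal, which is
-- Δ_n = Sym(Id_n, Id_n). Conversely, "every coordinate is the identity or the
-- reversal" passes to patterns and is invariant under symmetries, while
-- (123,132) does not have it. For n ≤ 2 there is no room for a pattern of size 3,
-- and for n = 3 an embedding of a pattern of size 3 must be the identity.
module Submission where

open import Defs
open import Data.Nat using (ℕ; _≤_)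
open import Data.Product using (_×_)
open import Function.Bundles using (_⇔_)
open import Relation.Nullary using (¬_)

open import Data.Bool using (Bool; true; false; not; _∧_; _∨_; _xor_; T)
import Data.Bool.Properties as Bool
open import Data.Empty using (⊥-elim)
open import Data.Fin using (Fin; zero; suc; toℕ; fromℕ<; opposite; punchIn; _<_; _<?_)
open import Data.Fin.Patterns using (0F; 1F; 2F; 3F; 4F; 5F)
open import Data.Fin.Permutation
  using (Permutation′; _⟨$⟩ʳ_; _⟨$⟩ˡ_; inverseˡ; inverseʳ; id; reverse; flip; _∘ₚ_; transpose)
import Data.Fin.Properties as Fin
open import Data.List using (List; []; _∷_; [_])
open import Data.List.Effectful using (monad)
open import Data.List.Relation.Unary.Any using (Any; any?; satisfied)
import Data.Nat as ℕ
import Data.Nat.Properties as ℕ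
open import Data.Product using (∃-syntax; _,_; proj₁; proj₂)
import Data.Product.Properties as Product
open import Data.Unit using (tt)
open import Data.Vec using (Vec; []; _∷_; lookup; zipWith)
import Data.Vec.Properties as Vec
open import Effect.Monad using (RawMonad)
open import Function using (_∘_)
open import Function.Bundles using (mk⇔; Equivalence)
open import Function.Definitions using (Injective)
open import Level using (0ℓ)
open import Relation.Binary.Core using (_Preserves_⟶_)
open import Relation.Binary.Definitions using (tri<; tri≈; tri>)
open import Relation.Binary.PropositionalEquality
  using (_≡_; _≢_; refl; sym; trans; cong; subst; subst₂; module ≡-Reasoning)
open import Relation.Nullary using (Dec; yes; no; does; isYes; contradiction)
open import Relation.Nullary.Decidable using (dec-true; dec-false; decidable-stable; toWitness)

private
  variable
    k m n : ℕ

_<ᵇ_ : Fin n → Fin n → Bool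
x <ᵇ y = does (x <? y)

does-≡⇒⇔ : ∀ {a b} {A : Set a} {B : Set b} (a? : Dec A) (b? : Dec B) → does a? ≡ does b? → A ⇔ B
does-≡⇒⇔ (yes a) (yes b) _ = mk⇔ (λ _ → b) (λ _ → a)
does-≡⇒⇔ (no ¬a) (no ¬b) _ = mk⇔ (⊥-elim ∘ ¬a) (⊥-elim ∘ ¬b)

<ᵇ-≡⇒⇔ : {x y : Fin m} {x′ y′ : Fin n} → x <ᵇ y ≡ x′ <ᵇ y′ → (x < y) ⇔ (x′ < y′)
<ᵇ-≡⇒⇔ {x = x} {y} {x′} {y′} = does-≡⇒⇔ (x <? y) (x′ <? y′)

<ᵇ-true⇒< : {x y : Fin n} → x <ᵇ y ≡ true → x < y
<ᵇ-true⇒< {x = x} {y} eq =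
  decidable-stable (x <? y) λ x≮y → contradiction (trans (sym eq) (dec-false (x <? y) x≮y)) λ ()

<ᵇ-false⇒> : {x y : Fin n} → x ≢ y → x <ᵇ y ≡ false → y < x
<ᵇ-false⇒> {x = x} {y} x≢y eq with Fin.<-cmp x y
... | tri< x<y _ _ = contradiction (trans (sym (dec-true (x <? y) x<y)) eq) λ ()
... | tri≈ _ x≡y _ = contradiction x≡y x≢y
... | tri> _ _ y<x = y<x

<ᵇ-irrefl : (x : Fin n) → x <ᵇ x ≡ false
<ᵇ-irrefl x = dec-false (x <? x) (Fin.<-irrefl refl)

<ᵇ-flip : {x y : Fin n} → x ≢ y → y <ᵇ x ≡ not (x <ᵇ y)
<ᵇ-flip {x = x} {y} x≢y with Fin.<-cmp x y
... | tri< x<y _ y≮x = trans (dec-false (y <? x) y≮x) (cong not (sym (dec-true (x <? y) x<y)))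
... | tri≈ _ x≡y _ = contradiction x≡y x≢y
... | tri> x≮y _ y<x = trans (dec-true (y <? x) y<x) (cong not (sym (dec-false (x <? y) x≮y)))

opposite-< : {x y : Fin n} → x < y → opposite y < opposite x
opposite-< {x = x} {y} x<y
  rewrite Fin.opposite-prop x | Fin.opposite-prop y = ℕ.∸-monoʳ-< (ℕ.s≤s x<y) (Fin.toℕ<n y)

opposite-<-⇔ : {x y : Fin n} → (opposite x < opposite y) ⇔ (y < x)
opposite-<-⇔ {x = x} {y} = mk⇔
  (λ lt → subst₂ _<_ (Fin.opposite-involutive y) (Fin.opposite-involutive x) (opposite-< lt))
  opposite-<

permutation-injective : (π : Permutation′ n) → Injective _≡_ _≡_ (π ⟨$⟩ʳ_)
permutation-injective π eq = trans (sym (inverseˡ π)) (trans (cong (π ⟨$⟩ˡ_) eq) (inverseˡ π))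

increasing⇒≥ : {f : Fin m → Fin n} → f Preserves _<_ ⟶ _<_ → ∀ i → toℕ i ℕ.≤ toℕ (f i)
increasing⇒≥ {m = m} {f = f} inc i =
  subst (λ j → toℕ i ℕ.≤ toℕ (f j)) (Fin.fromℕ<-toℕ i (Fin.toℕ<n i)) (go (toℕ i) (Fin.toℕ<n i))
  where
  go : ∀ j (j<m : j ℕ.< m) → j ℕ.≤ toℕ (f (fromℕ< j<m))
  go ℕ.zero _ = ℕ.z≤n
  go (ℕ.suc j) j+1<m = ℕ.≤-trans (ℕ.s≤s (go j j<m)) (inc step)
    where
    j<m = ℕ.<-trans (ℕ.n<1+n j) j+1<m
    step : fromℕ< j<m < fromℕ< j+1<m
    step rewrite Fin.toℕ-fromℕ< j<m | Fin.toℕ-fromℕ< j+1<m = ℕ.n<1+n j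

-- i ≤ f i, and the same applied to the conjugate of f by `opposite` gives f i ≤ i.
increasing⇒≗id : {f : Fin n → Fin n} → f Preserves _<_ ⟶ _<_ → ∀ i → f i ≡ i
increasing⇒≗id {f = f} inc i = Fin.toℕ-injective (ℕ.≤-antisym f≤i (increasing⇒≥ inc i))
  where
  conjugate : Fin _ → Fin _
  conjugate = opposite ∘ f ∘ opposite
  f≤i : toℕ (f i) ℕ.≤ toℕ i
  f≤i = ℕ.≮⇒≥ λ i<fi →
    ℕ.<-irrefl refl (ℕ.≤-<-trans (increasing⇒≥ (opposite-< ∘ inc ∘ opposite-<) (opposite i)) (reversed i<fi))
    where
    reversed : i < f i → conjugate (opposite i) < opposite i
    reversed lt rewrite Fin.opposite-involutive i = opposite-< lt

increasing⇒injective : {f : Fin m → Fin n} → f Preserves _<_ ⟶ _<_ → Injective _≡_ _≡_ f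
increasing⇒injective {f = f} inc {i} {j} fi≡fj with Fin.<-cmp i j
... | tri< i<j _ _ = contradiction fi≡fj (Fin.<⇒≢ (inc i<j))
... | tri≈ _ i≡j _ = i≡j
... | tri> _ _ j<i = contradiction (sym fi≡fj) (Fin.<⇒≢ (inc j<i))

increasing⇒order-iso : {f : Fin m → Fin n} → f Preserves _<_ ⟶ _<_ → ∀ a b → (f a < f b) ⇔ (a < b)
increasing⇒order-iso {f = f} inc a b = mk⇔ reflects inc
  where
  reflects : f a < f b → a < b
  reflects fa<fb with Fin.<-cmp a b
  ... | tri< a<b _ _ = a<b
  ... | tri≈ _ refl _ = contradiction fa<fb (Fin.<-irrefl refl)
  ... | tri> _ _ b<a = contradiction fa<fb (Fin.<-asym (inc b<a))

order-iso⇒≗ : (g : Fin n → Fin n) (h : Permutation′ n) →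
  (∀ {i j} → h ⟨$⟩ʳ i < h ⟨$⟩ʳ j → g i < g j) → ∀ i → g i ≡ h ⟨$⟩ʳ i
order-iso⇒≗ g h pres i = begin
  g i                    ≡⟨ cong g (inverseˡ h) ⟨
  g (h ⟨$⟩ˡ (h ⟨$⟩ʳ i))  ≡⟨ increasing⇒≗id inc (h ⟨$⟩ʳ i) ⟩
  h ⟨$⟩ʳ i               ∎
  where
  open ≡-Reasoning
  inc : (g ∘ (h ⟨$⟩ˡ_)) Preserves _<_ ⟶ _<_
  inc x<y = pres (subst₂ _<_ (sym (inverseʳ h)) (sym (inverseʳ h)) x<y)

punchIn-increasing : (k : Fin (ℕ.suc n)) → punchIn k Preserves _<_ ⟶ _<_
punchIn-increasing k {i} {j} i<j =
  Fin.≤∧≢⇒< (Fin.punchIn-mono-≤ k i j (ℕ.<⇒≤ i<j)) (Fin.<⇒≢ i<j ∘ Fin.punchIn-injective k i j)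

quadruple : Fin n → Fin n → Fin n → Fin n → Fin 4 → Fin n
quadruple a b c d 0F = a
quadruple a b c d 1F = b
quadruple a b c d 2F = c
quadruple a b c d 3F = d

quadruple-increasing : ∀ {a b c d : Fin n} → a < b → b < c → c < d → quadruple a b c d Preserves _<_ ⟶ _<_
quadruple-increasing a<b b<c c<d {0F} {1F} _ = a<b
quadruple-increasing a<b b<c c<d {0F} {2F} _ = Fin.<-trans a<b b<c
quadruple-increasing a<b b<c c<d {0F} {3F} _ = Fin.<-trans a<b (Fin.<-trans b<c c<d)
quadruple-increasing a<b b<c c<d {1F} {2F} _ = b<c
quadruple-increasing a<b b<c c<d {1F} {3F} _ = Fin.<-trans b<c c<d
quadruple-increasing a<b b<c c<d {2F} {3F} _ = c<d
quadruple-increasing a<b b<c c<d {0F} {0F} ()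
quadruple-increasing a<b b<c c<d {1F} {0F} ()
quadruple-increasing a<b b<c c<d {1F} {1F} (ℕ.s≤s ())
quadruple-increasing a<b b<c c<d {2F} {0F} ()
quadruple-increasing a<b b<c c<d {2F} {1F} (ℕ.s≤s ())
quadruple-increasing a<b b<c c<d {2F} {2F} (ℕ.s≤s (ℕ.s≤s ()))
quadruple-increasing a<b b<c c<d {3F} {0F} ()
quadruple-increasing a<b b<c c<d {3F} {1F} (ℕ.s≤s ())
quadruple-increasing a<b b<c c<d {3F} {2F} (ℕ.s≤s (ℕ.s≤s ()))
quadruple-increasing a<b b<c c<d {3F} {3F} (ℕ.s≤s (ℕ.s≤s (ℕ.s≤s ())))

coordinate : ThreePerm n → Fin 3 → Permutation′ n
coordinate (σ₁ , σ₂) 0F = id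
coordinate (σ₁ , σ₂) 1F = σ₁
coordinate (σ₁ , σ₂) 2F = σ₂

coordinate-point : (σ : ThreePerm n) (r : Fin 3) (i : Fin n) → coordinate σ r ⟨$⟩ʳ i ≡ point σ i r
coordinate-point (σ₁ , σ₂) 0F i = refl
coordinate-point (σ₁ , σ₂) 1F i = refl
coordinate-point (σ₁ , σ₂) 2F i = refl

embedding-increasing : {σ : ThreePerm n} {τ : ThreePerm k} ((f , _) : Contains σ τ) → f Preserves _<_ ⟶ _<_
embedding-increasing (f , iso) {i} {j} = Equivalence.from (iso i j 0F)

contains⇒≤ : {σ : ThreePerm n} {τ : ThreePerm k} → Contains σ τ → k ≤ n
contains⇒≤ c = Fin.injective⇒≤ (increasing⇒injective (embedding-increasing c))

contains-refl : (σ : ThreePerm n) → Contains σ σ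
contains-refl σ = (λ i → i) , λ i j r → mk⇔ (λ lt → lt) (λ lt → lt)

-- A pattern of the same size as σ can only be embedded by the identity.
contains⇒same-diagram : {σ τ : ThreePerm n} → Contains σ τ → ∀ i r → point σ i r ≡ point τ i r
contains⇒same-diagram {σ = σ} {τ} c@(f , iso) i r =
  trans (order-iso⇒≗ (λ x → point σ x r) (coordinate τ r) pres i) (coordinate-point τ r i)
  where
  f≗id = increasing⇒≗id (embedding-increasing c)
  pres : ∀ {x y} → coordinate τ r ⟨$⟩ʳ x < coordinate τ r ⟨$⟩ʳ y → point σ x r < point σ y r
  pres {x} {y} lt = subst₂ (λ a b → point σ a r < point σ b r) (f≗id x) (f≗id y)
    (Equivalence.from (iso x y r) (subst₂ _<_ (coordinate-point τ r x) (coordinate-point τ r y) lt))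

InSym-resp : {ρ ρ′ π : ThreePerm n} → (∀ i r → point ρ i r ≡ point ρ′ i r) → InSym ρ π → InSym ρ′ π
InSym-resp ρ≗ρ′ (s , img) = s , λ i r → trans (sym (ρ≗ρ′ _ r)) (img i r)

IdOrOpposite : (Fin n → Fin n) → Set
IdOrOpposite {n} g = ∃[ c ] ∀ (i : Fin n) → g i ≡ signAdj c i

-- Membership in Δ_n, read coordinatewise.
Diagonal : ThreePerm n → Set
Diagonal σ = ∀ r → IdOrOpposite (λ i → point σ i r)

signAdj-involutive : ∀ c (x : Fin n) → signAdj c (signAdj c x) ≡ x
signAdj-involutive true  x = refl
signAdj-involutive false x = Fin.opposite-involutive x

signAdj-idOrOpposite : ∀ c → IdOrOpposite (signAdj {n} c)
signAdj-idOrOpposite c = c , λ _ → refl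

signAdj-∘ : ∀ a b → IdOrOpposite (signAdj {n} a ∘ signAdj b)
signAdj-∘ true  b     = b , λ _ → refl
signAdj-∘ false true  = false , λ _ → refl
signAdj-∘ false false = true , Fin.opposite-involutive

signAdj-increasing : ∀ c {x y : Fin n} → x ≢ y → x <ᵇ y ≡ c → signAdj c x < signAdj c y
signAdj-increasing true  _   eq = <ᵇ-true⇒< eq
signAdj-increasing false x≢y eq = opposite-< (<ᵇ-false⇒> x≢y eq)

IdOrOpposite-resp : {f g : Fin n → Fin n} → (∀ i → f i ≡ g i) → IdOrOpposite g → IdOrOpposite f
IdOrOpposite-resp f≗g (c , g≗) = c , λ i → trans (f≗g i) (g≗ i)

IdOrOpposite-∘ : {f g : Fin n → Fin n} → IdOrOpposite f → IdOrOpposite g → IdOrOpposite (f ∘ g)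
IdOrOpposite-∘ {g = g} (a , f≗) (b , g≗) with signAdj-∘ a b
... | c , ab≗ = c , λ i → trans (f≗ (g i)) (trans (cong (signAdj a) (g≗ i)) (ab≗ i))

IdOrOpposite-cancelˡ : {f g : Fin n → Fin n} → IdOrOpposite f → IdOrOpposite (f ∘ g) → IdOrOpposite g
IdOrOpposite-cancelˡ {f = f} {g} (a , f≗) fg =
  IdOrOpposite-resp g≗ (IdOrOpposite-∘ (signAdj-idOrOpposite a) fg)
  where
  g≗ : ∀ i → g i ≡ signAdj a (f (g i))
  g≗ i = trans (sym (signAdj-involutive a (g i))) (cong (signAdj a) (sym (f≗ (g i))))

uniform⇒IdOrOpposite : (π : Permutation′ n) {c : Bool} →
  (∀ {p q} → p < q → (π ⟨$⟩ʳ p) <ᵇ (π ⟨$⟩ʳ q) ≡ c) → IdOrOpposite (π ⟨$⟩ʳ_)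
uniform⇒IdOrOpposite π {c} uniform =
  c , λ i → trans (sym (signAdj-involutive c _)) (cong (signAdj c) (increasing⇒≗id inc i))
  where
  inc : (signAdj c ∘ (π ⟨$⟩ʳ_)) Preserves _<_ ⟶ _<_
  inc p<q = signAdj-increasing c (Fin.<⇒≢ p<q ∘ permutation-injective π) (uniform p<q)

module _ {π ρ : ThreePerm n} {t : Permutation′ 3} {ε : Fin 3 → Bool} (img : IsImage (spm t ε) π ρ) where

  private
    column : Fin 3 → Fin n → Fin n
    column r i = actPoint (spm t ε) π i r

  Diagonal-image : Diagonal π → Diagonal ρ
  Diagonal-image dπ r = IdOrOpposite-resp ρ≗ (IdOrOpposite-∘ (columns r) (signAdj-idOrOpposite c₀))
    where
    columns : ∀ r → IdOrOpposite (column r)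
    columns r = IdOrOpposite-∘ (signAdj-idOrOpposite (ε r)) (dπ (t ⟨$⟩ʳ r))
    c₀ = proj₁ (columns 0F)
    ρ≗ : ∀ x → point ρ x r ≡ column r (signAdj c₀ x)
    ρ≗ x = trans (cong (λ y → point ρ y r) (sym (trans (proj₂ (columns 0F) _) (signAdj-involutive c₀ x))))
                 (img (signAdj c₀ x) r)

  -- Every coordinate of π is column 0 up to reversal, and one of them is the identity.
  Diagonal-preimage : Diagonal ρ → Diagonal π
  Diagonal-preimage dρ b =
    IdOrOpposite-resp (λ i → cong (point π i) (sym (inverseʳ t))) (via-column₀ (t ⟨$⟩ˡ b))
    where
    linked : ∀ r i → point π i (t ⟨$⟩ʳ r) ≡ signAdj (ε r) (signAdj (proj₁ (dρ r)) (column 0F i))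
    linked r i = trans (sym (signAdj-involutive (ε r) _))
                       (cong (signAdj (ε r)) (trans (sym (img i r)) (proj₂ (dρ r) _)))
    column₀ : IdOrOpposite (column 0F)
    column₀ = IdOrOpposite-cancelˡ (signAdj-∘ (ε r₀) (proj₁ (dρ r₀)))
      (IdOrOpposite-resp (λ i → sym (trans (cong (point π i) (sym (inverseʳ t))) (linked r₀ i)))
                         (signAdj-idOrOpposite true))
      where r₀ = t ⟨$⟩ˡ 0F
    via-column₀ : ∀ r → IdOrOpposite (λ i → point π i (t ⟨$⟩ʳ r))
    via-column₀ r = IdOrOpposite-resp (linked r) (IdOrOpposite-∘ (signAdj-∘ (ε r) (proj₁ (dρ r))) column₀)

IdId-diagonal : Diagonal (IdId n)
IdId-diagonal 0F = signAdj-idOrOpposite true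
IdId-diagonal 1F = signAdj-idOrOpposite true
IdId-diagonal 2F = signAdj-idOrOpposite true

p123-132-not-diagonal : ¬ Diagonal p123-132
p123-132-not-diagonal d with d 2F
... | true  , eq = contradiction (eq 1F) λ ()
... | false , eq = contradiction (eq 0F) λ ()

Diagonal⇒InSym-IdId : {σ : ThreePerm n} → Diagonal σ → InSym σ (IdId n)
Diagonal⇒InSym-IdId d = spm id sign , image
  where
  sign : Fin 3 → Bool
  sign 0F = true
  sign 1F = proj₁ (d 1F)
  sign 2F = proj₁ (d 2F)
  image : IsImage (spm id sign) (IdId _) _
  image i 0F = refl
  image i 1F = proj₂ (d 1F) i
  image i 2F = proj₂ (d 2F) i

contains-diagonal : {σ : ThreePerm n} {τ : ThreePerm k} → Diagonal σ → Contains σ τ → Diagonal τ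
contains-diagonal {σ = σ} {τ} d c@(f , iso) r with d r
... | s , σ≗ =
  s , λ i → trans (sym (coordinate-point τ r i)) (sym (order-iso⇒≗ (signAdj s) (coordinate τ r) pres i))
  where
  reflects : ∀ {x y} → f x < f y → x < y
  reflects {x} {y} = Equivalence.to (iso x y 0F)
  signAdj-reflects : ∀ c {x y} → signAdj c (f x) < signAdj c (f y) → signAdj c x < signAdj c y
  signAdj-reflects true  = reflects
  signAdj-reflects false = opposite-< ∘ reflects ∘ Equivalence.to opposite-<-⇔
  pres : ∀ {x y} → coordinate τ r ⟨$⟩ʳ x < coordinate τ r ⟨$⟩ʳ y → signAdj s x < signAdj s y
  pres {x} {y} lt = signAdj-reflects s (subst₂ _<_ (σ≗ (f x)) (σ≗ (f y))
    (Equivalence.from (iso x y r) (subst₂ _<_ (coordinate-point τ r x) (coordinate-point τ r y) lt)))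

diagonal⇒avoids : {σ : ThreePerm n} → Diagonal σ → AvoidsSym σ p123-132
diagonal⇒avoids d τ (spm t ε , img) c =
  p123-132-not-diagonal (Diagonal-preimage {t = t} {ε} img (contains-diagonal d c))

signPermutation : Bool → Permutation′ n
signPermutation true  = id
signPermutation false = reverse

signPermutation-signAdj : ∀ c (x : Fin n) → signPermutation c ⟨$⟩ʳ x ≡ signAdj c x
signPermutation-signAdj true  x = refl
signPermutation-signAdj false x = refl

column : SignedPermMatrix → ThreePerm n → Fin 3 → Permutation′ n
column (spm t ε) π r = coordinate π (t ⟨$⟩ʳ r) ∘ₚ signPermutation (ε r)

column-actPoint : ∀ s (π : ThreePerm n) r i → column s π r ⟨$⟩ʳ i ≡ actPoint s π i r
column-actPoint (spm t ε) π r i =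
  trans (signPermutation-signAdj (ε r) _) (cong (signAdj (ε r)) (coordinate-point π (t ⟨$⟩ʳ r) i))

-- s(π): the columns of s·P_π, re-indexed by the first one.
image : SignedPermMatrix → ThreePerm n → ThreePerm n
image s π = flip (column s π 0F) ∘ₚ column s π 1F , flip (column s π 0F) ∘ₚ column s π 2F

image-isImage : ∀ s (π : ThreePerm n) → IsImage s π (image s π)
image-isImage s π i r = begin
  point (image s π) (actPoint s π i 0F) r  ≡⟨ cong (λ x → point (image s π) x r) (column-actPoint s π 0F i) ⟨
  point (image s π) (column₀ ⟨$⟩ʳ i) r      ≡⟨ image-column r ⟩
  column s π r ⟨$⟩ʳ i                       ≡⟨ column-actPoint s π r i ⟩
  actPoint s π i r                          ∎
  where
  open ≡-Reasoning
  column₀ = column s π 0F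
  image-column : ∀ r → point (image s π) (column₀ ⟨$⟩ʳ i) r ≡ column s π r ⟨$⟩ʳ i
  image-column 0F = refl
  image-column 1F = cong (column s π 1F ⟨$⟩ʳ_) (inverseˡ column₀)
  image-column 2F = cong (column s π 2F ⟨$⟩ʳ_) (inverseˡ column₀)

signedPermutationMatrices : List SignedPermMatrix
signedPermutationMatrices = do
  t ← id ∷ transpose 0F 1F ∷ transpose 0F 2F ∷ transpose 1F 2F
         ∷ transpose 0F 1F ∘ₚ transpose 1F 2F ∷ transpose 1F 2F ∘ₚ transpose 0F 1F ∷ []
  a ← bools
  b ← bools
  c ← bools
  [ spm t (lookup (a ∷ b ∷ c ∷ [])) ]
  where
  open RawMonad (monad {0ℓ}) using (_>>=_)
  bools = true ∷ false ∷ []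

_⇒ᵇ_ : Bool → Bool → Bool
a ⇒ᵇ b = not a ∨ b

⇒ᵇ-elim : ∀ {a b} → T (a ⇒ᵇ b) → T a → T b
⇒ᵇ-elim {true} h _ = h

T-∧-intro : ∀ {x y} → T x → T y → T (x ∧ y)
T-∧-intro tx ty = Equivalence.from Bool.T-∧ (tx , ty)

¬T⇒T-not : ∀ {b} → ¬ T b → T (not b)
¬T⇒T-not {true}  ¬tb = ¬tb tt
¬T⇒T-not {false} _   = tt

every : ∀ n → (Vec Bool n → Bool) → Bool
every ℕ.zero    P = P []
every (ℕ.suc n) P = every n (P ∘ (true ∷_)) ∧ every n (P ∘ (false ∷_))

every-sound : ∀ {n} (P : Vec Bool n → Bool) → T (every n P) → ∀ v → T (P v)
every-sound P h []          = h
every-sound P h (true ∷ v)  = every-sound (P ∘ (true ∷_)) (proj₁ (Equivalence.to Bool.T-∧ h)) v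
every-sound P h (false ∷ v) = every-sound (P ∘ (false ∷_)) (proj₂ (Equivalence.to Bool.T-∧ h)) v

constant : Vec Bool n → Bool
constant []           = true
constant (x ∷ [])     = true
constant (x ∷ y ∷ xs) = not (x xor y) ∧ constant (y ∷ xs)

constant⇒≡head : ∀ {x} {xs : Vec Bool n} → T (constant (x ∷ xs)) → ∀ i → lookup (x ∷ xs) i ≡ x
constant⇒≡head              _ zero    = refl
constant⇒≡head {xs = _ ∷ _} h (suc i) with Equivalence.to Bool.T-∧ h
... | x≐y , rest = trans (constant⇒≡head rest i) (sym (≐⇒≡ x≐y))
  where
  ≐⇒≡ : ∀ {x y} → T (not (x xor y)) → x ≡ y
  ≐⇒≡ {true}  {true}  _ = refl
  ≐⇒≡ {false} {false} _ = refl

constant⇒lookup≡ : ∀ {x} {xs : Vec Bool n} → T (constant (x ∷ xs)) → ∀ i j → lookup (x ∷ xs) i ≡ lookup (x ∷ xs) j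
constant⇒lookup≡ h i j = trans (constant⇒≡head h i) (sym (constant⇒≡head h j))

exactlyOne : Bool → Bool → Bool → Bool
exactlyOne x y z = (x ∨ y ∨ z) ∧ not (x ∧ y) ∧ not (x ∧ z) ∧ not (y ∧ z)

comparisons₃ : (Fin 3 → Fin n) → Vec Bool 3
comparisons₃ v = v 0F <ᵇ v 1F ∷ v 0F <ᵇ v 2F ∷ v 1F <ᵇ v 2F ∷ []

comparisons₄ : (Fin 4 → Fin n) → Vec Bool 6
comparisons₄ v = v 0F <ᵇ v 1F ∷ v 0F <ᵇ v 2F ∷ v 0F <ᵇ v 3F ∷ v 1F <ᵇ v 2F ∷ v 1F <ᵇ v 3F ∷ v 2F <ᵇ v 3F ∷ []

-- Transitivity: the comparison of 0 and 2 is forced when those of (0,1) and (1,2) agree.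
realizable : Vec Bool 3 → Bool
realizable (x₀₁ ∷ x₀₂ ∷ x₁₂ ∷ []) = (x₀₁ xor x₁₂) ∨ not (x₀₁ xor x₀₂)

realizable-intro : ∀ {x y z} → (x ≡ true → z ≡ true → y ≡ true) → (x ≡ false → z ≡ false → y ≡ false) →
  T (realizable (x ∷ y ∷ z ∷ []))
realizable-intro {true}  {true}  {true}  _ _ = tt
realizable-intro {true}  {true}  {false} _ _ = tt
realizable-intro {true}  {false} {true}  f _ = contradiction (f refl refl) λ ()
realizable-intro {true}  {false} {false} _ _ = tt
realizable-intro {false} {true}  {true}  _ _ = tt
realizable-intro {false} {true}  {false} _ g = contradiction (g refl refl) λ ()
realizable-intro {false} {false} {true}  _ _ = tt
realizable-intro {false} {false} {false} _ _ = tt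

realizable-comparisons : {v : Fin 3 → Fin n} → Injective _≡_ _≡_ v → T (realizable (comparisons₃ v))
realizable-comparisons {v = v} inj = realizable-intro
  (λ e₀₁ e₁₂ → dec-true (v 0F <? v 2F) (Fin.<-trans (<ᵇ-true⇒< e₀₁) (<ᵇ-true⇒< e₁₂)))
  (λ e₀₁ e₁₂ → dec-false (v 0F <? v 2F)
     (Fin.<-asym (Fin.<-trans (<ᵇ-false⇒> (v≢ λ ()) e₁₂) (<ᵇ-false⇒> (v≢ λ ()) e₀₁))))
  where
  v≢ : ∀ {a b} → a ≢ b → v a ≢ v b
  v≢ a≢b = a≢b ∘ inj

comparisons-determine-order : {v : Fin 3 → Fin m} {w : Fin 3 → Fin n} →
  Injective _≡_ _≡_ v → Injective _≡_ _≡_ w →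
  comparisons₃ v ≡ comparisons₃ w → ∀ a b → v a <ᵇ v b ≡ w a <ᵇ w b
comparisons-determine-order {v = v} {w} v-inj w-inj eq = order
  where
  e₀₁ = Vec.∷-injectiveˡ eq
  e₀₂ = Vec.∷-injectiveˡ (Vec.∷-injectiveʳ eq)
  e₁₂ = Vec.∷-injectiveˡ (Vec.∷-injectiveʳ (Vec.∷-injectiveʳ eq))
  flipped : ∀ {a b} → a ≢ b → v a <ᵇ v b ≡ w a <ᵇ w b → v b <ᵇ v a ≡ w b <ᵇ w a
  flipped a≢b e = trans (<ᵇ-flip (a≢b ∘ v-inj)) (trans (cong not e) (sym (<ᵇ-flip (a≢b ∘ w-inj))))
  diagonal : ∀ a → v a <ᵇ v a ≡ w a <ᵇ w a
  diagonal a = trans (<ᵇ-irrefl (v a)) (sym (<ᵇ-irrefl (w a)))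
  order : ∀ a b → v a <ᵇ v b ≡ w a <ᵇ w b
  order 0F 0F = diagonal 0F
  order 0F 1F = e₀₁
  order 0F 2F = e₀₂
  order 1F 0F = flipped (λ ()) e₀₁
  order 1F 1F = diagonal 1F
  order 1F 2F = e₁₂
  order 2F 0F = flipped (λ ()) e₀₂
  order 2F 1F = flipped (λ ()) e₁₂
  order 2F 2F = diagonal 2F

-- Coordinate 0 is left out: along increasing positions u it is always increasing.
shapeAt : ThreePerm n → (Fin 3 → Fin n) → Vec Bool 3 × Vec Bool 3
shapeAt σ u = comparisons₃ (λ a → point σ (u a) 1F) , comparisons₃ (λ a → point σ (u a) 2F)

-- The projection to coordinates 1 and 2 is monotone iff they agree on all pairs or disagree on all pairs.
exactlyOneMonotone : Vec Bool 3 × Vec Bool 3 → Bool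
exactlyOneMonotone (a , b) = exactlyOne (constant a) (constant b) (constant (zipWith _xor_ a b))

shape-of-image? : ∀ ab → Dec (Any (λ s → shapeAt (image s p123-132) (λ a → a) ≡ ab) signedPermutationMatrices)
shape-of-image? ab = any? (λ s → Product.≡-dec (Vec.≡-dec Bool._≟_) (Vec.≡-dec Bool._≟_) _ ab) _

face : Fin 4 → Vec Bool 6 → Vec Bool 3
face 0F (x₀₁ ∷ x₀₂ ∷ x₀₃ ∷ x₁₂ ∷ x₁₃ ∷ x₂₃ ∷ []) = x₁₂ ∷ x₁₃ ∷ x₂₃ ∷ []
face 1F (x₀₁ ∷ x₀₂ ∷ x₀₃ ∷ x₁₂ ∷ x₁₃ ∷ x₂₃ ∷ []) = x₀₂ ∷ x₀₃ ∷ x₂₃ ∷ []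
face 2F (x₀₁ ∷ x₀₂ ∷ x₀₃ ∷ x₁₂ ∷ x₁₃ ∷ x₂₃ ∷ []) = x₀₁ ∷ x₀₃ ∷ x₁₃ ∷ []
face 3F (x₀₁ ∷ x₀₂ ∷ x₀₃ ∷ x₁₂ ∷ x₁₃ ∷ x₂₃ ∷ []) = x₀₁ ∷ x₀₂ ∷ x₁₂ ∷ []

face-comparisons : ∀ k (v : Fin 4 → Fin n) → face k (comparisons₄ v) ≡ comparisons₃ (v ∘ punchIn k)
face-comparisons 0F v = refl
face-comparisons 1F v = refl
face-comparisons 2F v = refl
face-comparisons 3F v = refl

everyFace : (Fin 4 → Bool) → Bool
everyFace P = P 0F ∧ P 1F ∧ P 2F ∧ P 3F

everyFace-intro : {P : Fin 4 → Bool} → (∀ k → T (P k)) → T (everyFace P)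
everyFace-intro h = T-∧-intro (h 0F) (T-∧-intro (h 1F) (T-∧-intro (h 2F) (h 3F)))

-- Opaque, so that unification never unfolds the exhaustive search behind the witness.
opaque
  exactlyOneMonotone⇒shape-of-image : ∀ a b → T (realizable a) → T (realizable b) →
    T (exactlyOneMonotone (a , b)) → ∃[ s ] shapeAt (image s p123-132) (λ a → a) ≡ (a , b)
  exactlyOneMonotone⇒shape-of-image a b ra rb one = satisfied (toWitness {a? = shape-of-image? (a , b)}
    (⇒ᵇ-elim (every-sound (claim a) (every-sound (every 3 ∘ claim) check a) b) (T-∧-intro ra (T-∧-intro rb one))))
    where
    claim : Vec Bool 3 → Vec Bool 3 → Bool
    claim a b = (realizable a ∧ realizable b ∧ exactlyOneMonotone (a , b)) ⇒ᵇ isYes (shape-of-image? (a , b))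
    check : T (every 3 (every 3 ∘ claim))
    check = tt

four-points-constant : ∀ a b →
  T (everyFace λ k → realizable (face k a) ∧ realizable (face k b) ∧ not (exactlyOneMonotone (face k a , face k b))) →
  T (constant a ∧ constant b)
four-points-constant a b = ⇒ᵇ-elim (every-sound (claim a) (every-sound (every 6 ∘ claim) check a) b)
  where
  claim : Vec Bool 6 → Vec Bool 6 → Bool
  claim a b =
    everyFace (λ k → realizable (face k a) ∧ realizable (face k b) ∧ not (exactlyOneMonotone (face k a , face k b)))
      ⇒ᵇ (constant a ∧ constant b)
  check : T (every 6 (every 6 ∘ claim))
  check = tt

exactlyOneMonotone⇒contains : (σ : ThreePerm n) (u : Fin 3 → Fin n) → u Preserves _<_ ⟶ _<_ →
  T (exactlyOneMonotone (shapeAt σ u)) → ∃[ s ] Contains σ (image s p123-132)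
exactlyOneMonotone⇒contains σ@(σ₁ , σ₂) u inc one = s , u , iso
  where
  along : (π : Permutation′ _) → Injective _≡_ _≡_ (λ a → π ⟨$⟩ʳ u a)
  along π e = increasing⇒injective inc (permutation-injective π e)
  found = exactlyOneMonotone⇒shape-of-image _ _
    (realizable-comparisons (along σ₁)) (realizable-comparisons (along σ₂)) one
  s = proj₁ found
  τ = image s p123-132
  iso : ∀ a b r → (point σ (u a) r < point σ (u b) r) ⇔ (point τ a r < point τ b r)
  iso a b 0F = increasing⇒order-iso inc a b
  iso a b 1F = <ᵇ-≡⇒⇔ (comparisons-determine-order (along σ₁) (permutation-injective (proj₁ τ))
                                                   (sym (cong proj₁ (proj₂ found))) a b)
  iso a b 2F = <ᵇ-≡⇒⇔ (comparisons-determine-order (along σ₂) (permutation-injective (proj₂ τ))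
                                                   (sym (cong proj₂ (proj₂ found))) a b)

avoids⇒no-exactlyOneMonotone : {σ : ThreePerm n} → AvoidsSym σ p123-132 →
  (u : Fin 3 → Fin n) → u Preserves _<_ ⟶ _<_ → ¬ T (exactlyOneMonotone (shapeAt σ u))
avoids⇒no-exactlyOneMonotone av u inc one with exactlyOneMonotone⇒contains _ u inc one
... | s , c = av (image s p123-132) (s , image-isImage s p123-132) c

no-exactlyOneMonotone⇒constant : ((σ₁ , σ₂) : ThreePerm n) (u : Fin 4 → Fin n) → u Preserves _<_ ⟶ _<_ →
  (∀ k → ¬ T (exactlyOneMonotone (shapeAt (σ₁ , σ₂) (u ∘ punchIn k)))) →
  T (constant (comparisons₄ ((σ₁ ⟨$⟩ʳ_) ∘ u)) ∧ constant (comparisons₄ ((σ₂ ⟨$⟩ʳ_) ∘ u)))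
no-exactlyOneMonotone⇒constant (σ₁ , σ₂) u inc none = four-points-constant a b (everyFace-intro faces)
  where
  values : Permutation′ _ → Fin 4 → Fin _
  values π = (π ⟨$⟩ʳ_) ∘ u
  a = comparisons₄ (values σ₁)
  b = comparisons₄ (values σ₂)
  realizable-face : ∀ π k → T (realizable (face k (comparisons₄ (values π))))
  realizable-face π k = subst (T ∘ realizable) (sym (face-comparisons k (values π)))
    (realizable-comparisons {v = values π ∘ punchIn k}
      λ e → Fin.punchIn-injective k _ _ (increasing⇒injective inc (permutation-injective π e)))
  faces : ∀ k → T (realizable (face k a) ∧ realizable (face k b) ∧ not (exactlyOneMonotone (face k a , face k b)))
  faces k = T-∧-intro (realizable-face σ₁ k) (T-∧-intro (realizable-face σ₂ k)
    (subst₂ (λ x y → T (not (exactlyOneMonotone (x , y))))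
            (sym (face-comparisons k (values σ₁))) (sym (face-comparisons k (values σ₂)))
            (¬T⇒T-not (none k))))

-- Every pair p < q lies in a quadruple together with the pair 0 < 1.
constant-quadruples⇒uniform : (v : Fin (4 ℕ.+ m) → Fin n) →
  (∀ u → u Preserves _<_ ⟶ _<_ → T (constant (comparisons₄ (v ∘ u)))) →
  ∀ {p q} → p < q → v p <ᵇ v q ≡ v 0F <ᵇ v 1F
constant-quadruples⇒uniform v constant₄ = uniform
  where
  at : ∀ u → u Preserves _<_ ⟶ _<_ → ∀ i → lookup (comparisons₄ (v ∘ u)) i ≡ v (u 0F) <ᵇ v (u 1F)
  at u inc i = constant⇒lookup≡ (constant₄ u inc) i 0F
  uniform : ∀ {p q} → p < q → v p <ᵇ v q ≡ v 0F <ᵇ v 1F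
  uniform {0F} {1F} _ = refl
  uniform {0F} {2F} _ =
    at (quadruple 0F 1F 2F 3F) (quadruple-increasing ℕ.z<s (ℕ.s<s ℕ.z<s) (ℕ.s<s (ℕ.s<s ℕ.z<s))) 1F
  uniform {0F} {q@(suc (suc (suc _)))} _ =
    at (quadruple 0F 1F 2F q) (quadruple-increasing ℕ.z<s (ℕ.s<s ℕ.z<s) (ℕ.s<s (ℕ.s<s ℕ.z<s))) 2F
  uniform {1F} {1F} (ℕ.s≤s ())
  uniform {1F} {2F} _ =
    at (quadruple 0F 1F 2F 3F) (quadruple-increasing ℕ.z<s (ℕ.s<s ℕ.z<s) (ℕ.s<s (ℕ.s<s ℕ.z<s))) 3F
  uniform {1F} {q@(suc (suc (suc _)))} _ =
    at (quadruple 0F 1F 2F q) (quadruple-increasing ℕ.z<s (ℕ.s<s ℕ.z<s) (ℕ.s<s (ℕ.s<s ℕ.z<s))) 4F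
  uniform {p@(suc (suc _))} {q} p<q = at (quadruple 0F 1F p q) (quadruple-increasing ℕ.z<s (ℕ.s<s ℕ.z<s) p<q) 5F

avoids⇒diagonal : (σ : ThreePerm (4 ℕ.+ m)) → AvoidsSym σ p123-132 → Diagonal σ
avoids⇒diagonal (σ₁ , σ₂) av = λ
  { 0F → signAdj-idOrOpposite true
  ; 1F → uniform⇒IdOrOpposite σ₁ (constant-quadruples⇒uniform (σ₁ ⟨$⟩ʳ_) λ u inc → proj₁ (constant₄ u inc))
  ; 2F → uniform⇒IdOrOpposite σ₂ (constant-quadruples⇒uniform (σ₂ ⟨$⟩ʳ_) λ u inc → proj₂ (constant₄ u inc))
  }
  where
  constant₄ : ∀ u → u Preserves _<_ ⟶ _<_ →
    T (constant (comparisons₄ ((σ₁ ⟨$⟩ʳ_) ∘ u))) × T (constant (comparisons₄ ((σ₂ ⟨$⟩ʳ_) ∘ u)))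
  constant₄ u inc = Equivalence.to Bool.T-∧ (no-exactlyOneMonotone⇒constant (σ₁ , σ₂) u inc
    λ k → avoids⇒no-exactlyOneMonotone av (u ∘ punchIn k) (inc ∘ punchIn-increasing k))

proposition4 :
    ((n : ℕ) → n ≤ 2 → (σ : ThreePerm n) → AvoidsSym σ p123-132)
    × ((σ : ThreePerm 3) → AvoidsSym σ p123-132 ⇔ (¬ InSym σ p123-132))
    × ((n : ℕ) → 4 ≤ n → (σ : ThreePerm n) → AvoidsSym σ p123-132 ⇔ InSym σ (IdId n))
proposition4 = small , size-three , large
  where
  small : (n : ℕ) → n ≤ 2 → (σ : ThreePerm n) → AvoidsSym σ p123-132
  small n n≤2 σ τ _ c = ℕ.<-irrefl refl (ℕ.≤-trans (contains⇒≤ c) n≤2)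
  size-three : (σ : ThreePerm 3) → AvoidsSym σ p123-132 ⇔ (¬ InSym σ p123-132)
  size-three σ = mk⇔
    (λ avoids σ∈Σ → avoids σ σ∈Σ (contains-refl σ))
    (λ σ∉Σ τ τ∈Σ c → σ∉Σ (InSym-resp (λ i r → sym (contains⇒same-diagram c i r)) τ∈Σ))
  large : (n : ℕ) → 4 ≤ n → (σ : ThreePerm n) → AvoidsSym σ p123-132 ⇔ InSym σ (IdId n)
  large _ (ℕ.s≤s (ℕ.s≤s (ℕ.s≤s (ℕ.s≤s _)))) σ = mk⇔
    (Diagonal⇒InSym-IdId ∘ avoids⇒diagonal σ)
    (λ { (spm t ε , img) → diagonal⇒avoids (Diagonal-image {t = t} {ε} img IdId-diagonal) })
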